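{- $15\notin\mathbb{M}_2$.
   Context: For a product $m=pq$ of two distinct odd primes $p,q$: let $t$ be the multiplicative order of $2$ modulo $m$, and let $\gamma_m\in\mathbb{F}_{2^{t}}^{*}$ be a primitive $m$-th root of unity. The canonical set of $m$ is $S_m=\{s_{11},s_{01},s_{10}\}\subseteq\mathbb{Z}_m$, where $s_{\sigma_1\sigma_2}\in\mathbb{Z}_m$ is the unique residue with $s_{\sigma_1\sigma_2}\equiv\sigma_1 \pmod p$ and $s_{\sigma_1\sigma_2}\equiv\sigma_2\pmod q$. An $S_m$-decoding polynomial is a polynomial $P(X)\in\mathbb{F}_{2^{t}}[X]$ with $P(\gamma_m^{s})=0$ for all $s\in S_m$ and $P(1)=1$. $\mathbb{M}_2$ denotes the set of integers $m=pq$, with $p,q$ distinct odd primes, that yield a $3$-query linear locally decodable code in Efremenko's construction; concretely, $m\in\mathbb{M}_2$ means there exists an $S_m$-decoding polynomial with (at most, equivalently exactly) three monomials. -}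

module Defs where

open import Data.Bool using (Bool; true; false; _xor_; _∧_)
open import Data.Nat using (ℕ; zero; suc; _%_; _<_; _≤_)
open import Data.List using (List; []; _∷_)
open import Data.Product using (_×_; _,_)
open import Data.Sum using (_⊎_)
open import Relation.Binary.PropositionalEquality using (_≡_; _≢_)

-- m = 15 = 3 * 5, p = 3, q = 5.
-- The multiplicative order of 2 modulo 15 is t = 4 (2^4 = 16 ≡ 1 mod 15,
-- and 2, 4, 8 ≢ 1 mod 15), so the field is F_{2^4} = F_16.

-- F_16 realised as F_2[x]/(x^4 + x + 1) (x^4+x+1 is irreducible over F_2).
-- An element (a0 , a1 , a2 , a3) stands for a0 + a1 x + a2 x^2 + a3 x^3.
record F16 : Set where
  constructor f16
  field
    c0 c1 c2 c3 : Bool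

0F : F16
0F = f16 false false false false

1F : F16
1F = f16 true false false false

_+F_ : F16 → F16 → F16
f16 a0 a1 a2 a3 +F f16 b0 b1 b2 b3 = f16 (a0 xor b0) (a1 xor b1) (a2 xor b2) (a3 xor b3)

-- multiplication by x, using x^4 = x + 1
mulX : F16 → F16
mulX (f16 a0 a1 a2 a3) = f16 a3 (a0 xor a3) a1 a2

scale : Bool → F16 → F16
scale false _ = 0F
scale true  b = b

_*F_ : F16 → F16 → F16
f16 a0 a1 a2 a3 *F b =
  scale a0 b +F (scale a1 (mulX b) +F (scale a2 (mulX (mulX b)) +F scale a3 (mulX (mulX (mulX b)))))

_^F_ : F16 → ℕ → F16
a ^F zero  = 1F
a ^F suc n = a *F (a ^F n)

IsPrimitiveRoot15 : F16 → Set
IsPrimitiveRoot15 γ = (γ ^F 15 ≡ 1F) × (∀ k → 0 < k → k < 15 → γ ^F k ≢ 1F)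

-- Polynomials in F16[X] as dense coefficient lists (constant term first).
Poly : Set
Poly = List F16

eval : Poly → F16 → F16
eval []       x = 0F
eval (c ∷ cs) x = c +F (x *F eval cs x)

isZero : F16 → Bool
isZero (f16 false false false false) = true
isZero _ = false

numMonomials : Poly → ℕ
numMonomials [] = 0
numMonomials (c ∷ cs) with isZero c
... | true  = numMonomials cs
... | false = suc (numMonomials cs)

InCanonicalSet : (p q : ℕ) → ℕ → Set
InCanonicalSet p q s =
  s < p Data.Nat.* q ×
  (((s % suc (p Data.Nat.∸ 1) ≡ 1) × (s % suc (q Data.Nat.∸ 1) ≡ 1)) ⊎
   ((s % suc (p Data.Nat.∸ 1) ≡ 0) × (s % suc (q Data.Nat.∸ 1) ≡ 1)) ⊎
   ((s % suc (p Data.Nat.∸ 1) ≡ 1) × (s % suc (q Data.Nat.∸ 1) ≡ 0)))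

IsDecodingPoly15 : F16 → Poly → Set
IsDecodingPoly15 γ P =
  (∀ s → InCanonicalSet 3 5 s → eval P (γ ^F s) ≡ 0F) × (eval P 1F ≡ 1F)

module Submission where

-- Padding with zero coefficients, such a P agrees as a function with a
-- trinomial a Xⁱ + b Xʲ + c Xᵏ. At a 15th root of unity y we may divide by yⁱ,
-- i.e. multiply by y^(14 i): the trinomial vanishes at y iff a + b y^J + c y^K
-- does, where J, K are j - i and k - i reduced modulo 15. Evaluating at 1 gives
-- a + b + c = 1, so c = 1 + a + b. Hence a decoding polynomial for γ yields
-- a, b ∈ 𝔽₁₆ and J, K < 15 such that a + b Y^J + (1 + a + b) Y^K vanishes at
-- γ, γ⁶ and γ¹⁰, and a finite search over all elements of order 15 shows that
-- no such data exists.

open import Defs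
open import Data.Nat using (_≤_)
open import Data.Empty using (⊥; ⊥-elim)

open import Data.Bool using (Bool; true; false)
open import Data.Bool.Properties using () renaming (_≟_ to _≟ᵇ_)
open import Data.Fin using (Fin; toℕ)
open import Data.Fin.Properties using (all?; toℕ-fromℕ<)
open import Data.List using (List; []; _∷_; length; map; foldr)
open import Data.List.Properties using (length-map)
open import Data.Nat using (ℕ; zero; suc; _+_; _*_; _%_; _/_; NonZero; s≤s; z≤n)
open import Data.Nat.DivMod using (_mod_; m≡m%n+[m/n]*n; m*n%n≡0)
open import Data.Nat.Properties using (*-comm; *-suc; +-comm; <ᵇ⇒<)
open import Data.Product using (Σ; _×_; _,_; map₂)
open import Data.Sum using (inj₁; inj₂)
open import Data.Unit using (tt)
open import Relation.Binary.Definitions using (DecidableEquality)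
open import Relation.Binary.PropositionalEquality
  using (_≡_; _≢_; refl; sym; trans; cong; cong₂; subst; module ≡-Reasoning)
open import Relation.Nullary using (Dec; ¬_; ¬?; _×-dec_; _→-dec_)
open import Relation.Nullary.Decidable using (map′; yes)

open ≡-Reasoning

infix 4 _≟F_

_≟F_ : DecidableEquality F16
f16 a₀ a₁ a₂ a₃ ≟F f16 b₀ b₁ b₂ b₃ =
  map′ (λ { (refl , refl , refl , refl) → refl })
       (λ { refl → refl , refl , refl , refl })
       (a₀ ≟ᵇ b₀ ×-dec a₁ ≟ᵇ b₁ ×-dec a₂ ≟ᵇ b₂ ×-dec a₃ ≟ᵇ b₃)

∀-Bool? : {P : Bool → Set} → (∀ b → Dec (P b)) → Dec (∀ b → P b)
∀-Bool? P? = map′ (λ { (pf , pt) false → pf ; (pf , pt) true → pt })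
                  (λ h → h false , h true)
                  (P? false ×-dec P? true)

-- Universal statements over the 16 field elements are decidable; this is
-- what turns every closed finite fact below into a computation.
∀-F16? : {P : F16 → Set} → (∀ x → Dec (P x)) → Dec (∀ x → P x)
∀-F16? P? =
  map′ (λ h x → h (F16.c0 x) (F16.c1 x) (F16.c2 x) (F16.c3 x))
       (λ h a b c d → h (f16 a b c d))
       (∀-Bool? λ a → ∀-Bool? λ b → ∀-Bool? λ c → ∀-Bool? λ d → P? (f16 a b c d))

-- A proposition holds once its decision procedure evaluates to `yes`. (This
-- is `toWitness`, phrased with a Boolean equation because checking `refl`
-- against it is markedly cheaper for the large search below.)
byDecision : {A : Set} (a? : Dec A) → Dec.does a? ≡ true → A
byDecision (yes a) _ = a

+F-identityʳ : ∀ x → x +F 0F ≡ x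
+F-identityʳ = byDecision (∀-F16? λ x → x +F 0F ≟F x) refl

*F-identityˡ : ∀ x → 1F *F x ≡ x
*F-identityˡ = byDecision (∀-F16? λ x → 1F *F x ≟F x) refl

*F-identityʳ : ∀ x → x *F 1F ≡ x
*F-identityʳ = byDecision (∀-F16? λ x → x *F 1F ≟F x) refl

*F-zeroʳ : ∀ x → x *F 0F ≡ 0F
*F-zeroʳ = byDecision (∀-F16? λ x → x *F 0F ≟F 0F) refl

*F-comm : ∀ x y → x *F y ≡ y *F x
*F-comm = byDecision (∀-F16? λ x → ∀-F16? λ y → x *F y ≟F y *F x) refl

*F-assoc : ∀ x y z → (x *F y) *F z ≡ x *F (y *F z)
*F-assoc = byDecision
  (∀-F16? λ x → ∀-F16? λ y → ∀-F16? λ z → (x *F y) *F z ≟F x *F (y *F z)) refl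

*F-distribˡ-+F : ∀ x y z → x *F (y +F z) ≡ (x *F y) +F (x *F z)
*F-distribˡ-+F = byDecision
  (∀-F16? λ x → ∀-F16? λ y → ∀-F16? λ z → x *F (y +F z) ≟F (x *F y) +F (x *F z)) refl

solve-last : ∀ a b c → a +F (b +F (c +F 0F)) ≡ 1F → c ≡ 1F +F (a +F b)
solve-last = byDecision
  (∀-F16? λ a → ∀-F16? λ b → ∀-F16? λ c →
     a +F (b +F (c +F 0F)) ≟F 1F →-dec c ≟F 1F +F (a +F b)) refl

*F-left-comm : ∀ x y z → x *F (y *F z) ≡ y *F (x *F z)
*F-left-comm x y z = begin
  x *F (y *F z)  ≡⟨ sym (*F-assoc x y z) ⟩
  (x *F y) *F z  ≡⟨ cong (_*F z) (*F-comm x y) ⟩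
  (y *F x) *F z  ≡⟨ *F-assoc y x z ⟩
  y *F (x *F z)  ∎

^F-+ : ∀ x m n → x ^F (m + n) ≡ (x ^F m) *F (x ^F n)
^F-+ x zero    n = sym (*F-identityˡ (x ^F n))
^F-+ x (suc m) n = begin
  x *F (x ^F (m + n))            ≡⟨ cong (x *F_) (^F-+ x m n) ⟩
  x *F ((x ^F m) *F (x ^F n))    ≡⟨ sym (*F-assoc x (x ^F m) (x ^F n)) ⟩
  (x *F (x ^F m)) *F (x ^F n)    ∎

^F-* : ∀ x q n → x ^F (q * n) ≡ (x ^F n) ^F q
^F-* x zero    n = refl
^F-* x (suc q) n = trans (^F-+ x n (q * n)) (cong ((x ^F n) *F_) (^F-* x q n))

1^F : ∀ n → 1F ^F n ≡ 1F
1^F zero    = refl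
1^F (suc n) = trans (*F-identityˡ (1F ^F n)) (1^F n)

^F-root : ∀ x n s → x ^F n ≡ 1F → (x ^F s) ^F n ≡ 1F
^F-root x n s xⁿ≡1 = begin
  (x ^F s) ^F n   ≡⟨ sym (^F-* x n s) ⟩
  x ^F (n * s)    ≡⟨ cong (x ^F_) (*-comm n s) ⟩
  x ^F (s * n)    ≡⟨ ^F-* x s n ⟩
  (x ^F n) ^F s   ≡⟨ cong (_^F s) xⁿ≡1 ⟩
  1F ^F s         ≡⟨ 1^F s ⟩
  1F              ∎

^F-mod : ∀ x n .{{_ : NonZero n}} e → x ^F n ≡ 1F → x ^F e ≡ x ^F toℕ (e mod n)
^F-mod x n e xⁿ≡1 = begin
  x ^F e                                 ≡⟨ cong (x ^F_) (m≡m%n+[m/n]*n e n) ⟩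
  x ^F (e % n + (e / n) * n)             ≡⟨ ^F-+ x (e % n) ((e / n) * n) ⟩
  (x ^F (e % n)) *F (x ^F ((e / n) * n)) ≡⟨ cong ((x ^F (e % n)) *F_) multiple≡1 ⟩
  (x ^F (e % n)) *F 1F                   ≡⟨ *F-identityʳ (x ^F (e % n)) ⟩
  x ^F (e % n)                           ≡⟨ cong (x ^F_) (sym (toℕ-fromℕ< _)) ⟩
  x ^F toℕ (e mod n)                     ∎
  where
  multiple≡1 : x ^F ((e / n) * n) ≡ 1F
  multiple≡1 = trans (^F-* x (e / n) n) (trans (cong (_^F (e / n)) xⁿ≡1) (1^F (e / n)))

-- A list of (coefficient , exponent) pairs stands for Σ aₑ Xᵉ.
Terms : Set
Terms = List (F16 × ℕ)

evalTerms : Terms → F16 → F16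
evalTerms []             x = 0F
evalTerms ((a , e) ∷ ts) x = (a *F (x ^F e)) +F evalTerms ts x

raise : ℕ → Terms → Terms
raise d = map (map₂ (d +_))

evalTerms-raise : ∀ x d ts → (x ^F d) *F evalTerms ts x ≡ evalTerms (raise d ts) x
evalTerms-raise x d []             = *F-zeroʳ (x ^F d)
evalTerms-raise x d ((a , e) ∷ ts) = begin
  (x ^F d) *F ((a *F (x ^F e)) +F evalTerms ts x)
    ≡⟨ *F-distribˡ-+F (x ^F d) (a *F (x ^F e)) (evalTerms ts x) ⟩
  ((x ^F d) *F (a *F (x ^F e))) +F ((x ^F d) *F evalTerms ts x)
    ≡⟨ cong₂ _+F_ (*F-left-comm (x ^F d) a (x ^F e)) (evalTerms-raise x d ts) ⟩
  (a *F ((x ^F d) *F (x ^F e))) +F evalTerms (raise d ts) x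
    ≡⟨ cong (λ y → (a *F y) +F evalTerms (raise d ts) x) (sym (^F-+ x d e)) ⟩
  (a *F (x ^F (d + e))) +F evalTerms (raise d ts) x
    ∎

reduce : (n : ℕ) .{{_ : NonZero n}} → Terms → Terms
reduce n = map (map₂ (λ e → toℕ (e mod n)))

evalTerms-reduce : ∀ x n .{{_ : NonZero n}} ts → x ^F n ≡ 1F →
                   evalTerms ts x ≡ evalTerms (reduce n ts) x
evalTerms-reduce x n []             xⁿ≡1 = refl
evalTerms-reduce x n ((a , e) ∷ ts) xⁿ≡1 =
  cong₂ (λ y z → (a *F y) +F z) (^F-mod x n e xⁿ≡1) (evalTerms-reduce x n ts xⁿ≡1)

coefficientSum : Terms → F16
coefficientSum = foldr (λ (a , _) s → a +F s) 0F

evalTerms-one : ∀ ts → evalTerms ts 1F ≡ coefficientSum ts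
evalTerms-one []             = refl
evalTerms-one ((a , e) ∷ ts) =
  cong₂ _+F_ (trans (cong (a *F_) (1^F e)) (*F-identityʳ a)) (evalTerms-one ts)

monomials : Poly → Terms
monomials []       = []
monomials (c ∷ cs) with isZero c
... | true  = raise 1 (monomials cs)
... | false = (c , 0) ∷ raise 1 (monomials cs)

length-monomials : ∀ P → length (monomials P) ≡ numMonomials P
length-monomials []       = refl
length-monomials (c ∷ cs) with isZero c
... | true  = trans (length-map _ (monomials cs)) (length-monomials cs)
... | false = cong suc (trans (length-map _ (monomials cs)) (length-monomials cs))

isZero-sound : ∀ c → isZero c ≡ true → c ≡ 0F
isZero-sound (f16 false false false false) _ = refl

isZero? : ∀ x → Dec (x ≡ 0F)
isZero? x = map′ (isZero-sound x) (λ { refl → refl }) (isZero x ≟ᵇ true)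

eval-monomials : ∀ P x → eval P x ≡ evalTerms (monomials P) x
X*eval-monomials : ∀ P x → x *F eval P x ≡ evalTerms (raise 1 (monomials P)) x

eval-monomials []       x = refl
eval-monomials (c ∷ cs) x with isZero c in c≡0?
... | true  = trans (cong (_+F (x *F eval cs x)) (isZero-sound c c≡0?)) (X*eval-monomials cs x)
... | false = cong₂ _+F_ (sym (*F-identityʳ c)) (X*eval-monomials cs x)

X*eval-monomials P x =
  trans (cong₂ _*F_ (sym (*F-identityʳ x)) (eval-monomials P x))
        (evalTerms-raise x 1 (monomials P))

record Trinomial : Set where
  constructor trinomial
  field
    a : F16
    i : ℕ
    b : F16
    j : ℕ
    c : F16
    k : ℕ

  terms : Terms
  terms = (a , i) ∷ (b , j) ∷ (c , k) ∷ []

asTrinomial : ∀ ts → length ts ≤ 3 →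
              Σ Trinomial λ t → ∀ x → evalTerms ts x ≡ evalTerms (Trinomial.terms t) x
asTrinomial []                                  _ = trinomial 0F 0 0F 0 0F 0 , λ _ → refl
asTrinomial ((a , i) ∷ [])                      _ = trinomial a i 0F 0 0F 0 , λ _ → refl
asTrinomial ((a , i) ∷ (b , j) ∷ [])            _ = trinomial a i b j 0F 0 , λ _ → refl
asTrinomial ((a , i) ∷ (b , j) ∷ (c , k) ∷ [])  _ = trinomial a i b j c k , λ _ → refl
asTrinomial (_ ∷ _ ∷ _ ∷ _ ∷ _) (s≤s (s≤s (s≤s ())))

trinomialForm : ∀ P → numMonomials P ≤ 3 →
                Σ Trinomial λ t → ∀ x → eval P x ≡ evalTerms (Trinomial.terms t) x
trinomialForm P size =
  map₂ (λ same x → trans (eval-monomials P x) (same x))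
       (asTrinomial (monomials P) (subst (_≤ 3) (sym (length-monomials P)) size))

-- j - i modulo n = m + 1, computed as (m i + j) mod n.
relative : (m i j : ℕ) → Fin (suc m)
relative m i j = (i * m + j) mod suc m

-- The value a + b u + c v: the normalised trinomial a + b Y^J + c Y^K at a
-- point y with y^J = u and y^K = v.
normalisedValue : (a b c u v : F16) → F16
normalisedValue a b c u v = a +F ((b *F u) +F (c *F v))

-- At an (m+1)-th root of unity x, a vanishing trinomial may be divided by the
-- power of its first monomial: multiplying by x^(i m) = x^(-i) moves the
-- exponents i, j, k to 0, j - i, k - i (mod m + 1).
divide-by-first : ∀ t m x → x ^F suc m ≡ 1F → evalTerms (Trinomial.terms t) x ≡ 0F →
  let open Trinomial t in
  normalisedValue a b c (x ^F toℕ (relative m i j)) (x ^F toℕ (relative m i k)) ≡ 0F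
divide-by-first t@(trinomial a i b j c k) m x xⁿ≡1 t[x]≡0 = begin
  normalisedValue a b c (x ^F J) (x ^F K)
    ≡⟨ cong₂ (λ p q → p +F ((b *F (x ^F J)) +F q))
             (sym (*F-identityʳ a)) (sym (+F-identityʳ (c *F (x ^F K)))) ⟩
  evalTerms ((a , 0) ∷ (b , J) ∷ (c , K) ∷ []) x
    ≡⟨ cong (λ e → evalTerms ((a , e) ∷ (b , J) ∷ (c , K) ∷ []) x) (sym first-exponent) ⟩
  evalTerms (reduce (suc m) (raise (i * m) (Trinomial.terms t))) x
    ≡⟨ sym (evalTerms-reduce x (suc m) (raise (i * m) (Trinomial.terms t)) xⁿ≡1) ⟩
  evalTerms (raise (i * m) (Trinomial.terms t)) x
    ≡⟨ sym (evalTerms-raise x (i * m) (Trinomial.terms t)) ⟩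
  (x ^F (i * m)) *F evalTerms (Trinomial.terms t) x
    ≡⟨ cong ((x ^F (i * m)) *F_) t[x]≡0 ⟩
  (x ^F (i * m)) *F 0F
    ≡⟨ *F-zeroʳ (x ^F (i * m)) ⟩
  0F ∎
  where
  J K : ℕ
  J = toℕ (relative m i j)
  K = toℕ (relative m i k)
  first-exponent : toℕ (relative m i i) ≡ 0
  first-exponent = begin
    toℕ (relative m i i)  ≡⟨ toℕ-fromℕ< _ ⟩
    (i * m + i) % suc m   ≡⟨ cong (_% suc m) (trans (+-comm (i * m) i) (sym (*-suc i m))) ⟩
    (i * suc m) % suc m   ≡⟨ m*n%n≡0 i (suc m) ⟩
    0                     ∎

last-coefficient : ∀ t → evalTerms (Trinomial.terms t) 1F ≡ 1F →
                   Trinomial.c t ≡ 1F +F (Trinomial.a t +F Trinomial.b t)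
last-coefficient t@(trinomial a i b j c k) t[1]≡1 =
  solve-last a b c (trans (sym (evalTerms-one (Trinomial.terms t))) t[1]≡1)

VanishesAt : (a b u v : F16) → Set
VanishesAt a b u v = normalisedValue a b (1F +F (a +F b)) u v ≡ 0F

-- No normalised trinomial with coefficient sum 1 vanishes at three given
-- points. The points enter through their powers, so that these are computed
-- once per pair of exponents during the search.
NoCommonZero : (u₁ v₁ u₂ v₂ u₃ v₃ : F16) → Set
NoCommonZero u₁ v₁ u₂ v₂ u₃ v₃ =
  ∀ a b → ¬ (VanishesAt a b u₁ v₁ × VanishesAt a b u₂ v₂ × VanishesAt a b u₃ v₃)

noCommonZero? : ∀ u₁ v₁ u₂ v₂ u₃ v₃ → Dec (NoCommonZero u₁ v₁ u₂ v₂ u₃ v₃)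
noCommonZero? u₁ v₁ u₂ v₂ u₃ v₃ = ∀-F16? λ a → ∀-F16? λ b →
  ¬? (isZero? (normalisedValue a b (1F +F (a +F b)) u₁ v₁)
      ×-dec isZero? (normalisedValue a b (1F +F (a +F b)) u₂ v₂)
      ×-dec isZero? (normalisedValue a b (1F +F (a +F b)) u₃ v₃))

NoNormalisedDecoder : F16 → Set
NoNormalisedDecoder γ = ∀ (J K : Fin 15) →
  NoCommonZero ((γ ^F 1) ^F toℕ J)  ((γ ^F 1) ^F toℕ K)
               ((γ ^F 6) ^F toℕ J)  ((γ ^F 6) ^F toℕ K)
               ((γ ^F 10) ^F toℕ J) ((γ ^F 10) ^F toℕ K)

noNormalisedDecoder? : ∀ γ → Dec (NoNormalisedDecoder γ)
noNormalisedDecoder? γ = all? λ J → all? λ K →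
  noCommonZero? ((γ ^F 1) ^F toℕ J)  ((γ ^F 1) ^F toℕ K)
                ((γ ^F 6) ^F toℕ J)  ((γ ^F 6) ^F toℕ K)
                ((γ ^F 10) ^F toℕ J) ((γ ^F 10) ^F toℕ K)

-- The search itself. The hypotheses leave exactly the eight elements of order
-- 15; the search is run for each of them separately, which keeps every single
-- evaluation small.
noNormalisedDecoder : ∀ γ → γ ^F 15 ≡ 1F → γ ^F 3 ≢ 1F → γ ^F 5 ≢ 1F →
                      NoNormalisedDecoder γ
noNormalisedDecoder γ γ¹⁵≡1 γ³≢1 γ⁵≢1 =
  byDecision (noNormalisedDecoder? γ) (search-succeeds γ γ¹⁵≡1 γ³≢1 γ⁵≢1)
  where
  search-succeeds : ∀ γ → γ ^F 15 ≡ 1F → γ ^F 3 ≢ 1F → γ ^F 5 ≢ 1F →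
             Dec.does (noNormalisedDecoder? γ) ≡ true
  search-succeeds (f16 false false false false) () _ _
  search-succeeds (f16 true  false false false) _ γ³≢1 _ = ⊥-elim (γ³≢1 refl)
  search-succeeds (f16 false true  true  false) _ γ³≢1 _ = ⊥-elim (γ³≢1 refl)
  search-succeeds (f16 true  true  true  false) _ γ³≢1 _ = ⊥-elim (γ³≢1 refl)
  search-succeeds (f16 false false false true ) _ _ γ⁵≢1 = ⊥-elim (γ⁵≢1 refl)
  search-succeeds (f16 false false true  true ) _ _ γ⁵≢1 = ⊥-elim (γ⁵≢1 refl)
  search-succeeds (f16 false true  false true ) _ _ γ⁵≢1 = ⊥-elim (γ⁵≢1 refl)
  search-succeeds (f16 true  true  true  true ) _ _ γ⁵≢1 = ⊥-elim (γ⁵≢1 refl)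
  search-succeeds (f16 false true  false false) _ _ _ = refl
  search-succeeds (f16 false false true  false) _ _ _ = refl
  search-succeeds (f16 true  true  false false) _ _ _ = refl
  search-succeeds (f16 false true  true  true ) _ _ _ = refl
  search-succeeds (f16 true  false true  true ) _ _ _ = refl
  search-succeeds (f16 true  false true  false) _ _ _ = refl
  search-succeeds (f16 true  true  false true ) _ _ _ = refl
  search-succeeds (f16 true  false false true ) _ _ _ = refl

noDecodingTrinomial : ∀ γ → γ ^F 15 ≡ 1F → γ ^F 3 ≢ 1F → γ ^F 5 ≢ 1F → ∀ t →
  (∀ s → InCanonicalSet 3 5 s → evalTerms (Trinomial.terms t) (γ ^F s) ≡ 0F) →
  evalTerms (Trinomial.terms t) 1F ≡ 1F → ⊥
noDecodingTrinomial γ γ¹⁵≡1 γ³≢1 γ⁵≢1 t@(trinomial a i b j c k) t[γˢ]≡0 t[1]≡1 =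
  noNormalisedDecoder γ γ¹⁵≡1 γ³≢1 γ⁵≢1 (relative 14 i j) (relative 14 i k) a b
    ( zeroAt 1  (<ᵇ⇒< 1 15 tt , inj₁ (refl , refl))
    , zeroAt 6  (<ᵇ⇒< 6 15 tt , inj₂ (inj₁ (refl , refl)))
    , zeroAt 10 (<ᵇ⇒< 10 15 tt , inj₂ (inj₂ (refl , refl))) )
  where
  zeroAt : ∀ s → InCanonicalSet 3 5 s →
           VanishesAt a b ((γ ^F s) ^F toℕ (relative 14 i j)) ((γ ^F s) ^F toℕ (relative 14 i k))
  zeroAt s s∈S = subst (λ c′ → normalisedValue a b c′ _ _ ≡ 0F) (last-coefficient t t[1]≡1)
    (divide-by-first t 14 (γ ^F s) (^F-root γ 15 s γ¹⁵≡1) (t[γˢ]≡0 s s∈S))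

corollary3p10 : (γ : F16) → IsPrimitiveRoot15 γ → (P : Poly) →
    numMonomials P ≤ 3 → IsDecodingPoly15 γ P → ⊥
corollary3p10 γ (γ¹⁵≡1 , order≢) P size (vanishes , P[1]≡1) =
  let (t , P≗t) = trinomialForm P size in
  noDecodingTrinomial γ γ¹⁵≡1
    (order≢ 3 (s≤s z≤n) (<ᵇ⇒< 3 15 tt)) (order≢ 5 (s≤s z≤n) (<ᵇ⇒< 5 15 tt)) t
    (λ s s∈S → trans (sym (P≗t (γ ^F s))) (vanishes s s∈S))
    (trans (sym (P≗t 1F)) P[1]≡1)
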